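{- Let $H$ be a finite connected graph, let $C$ be an odd cycle, and let $f:C\to H$ be a homomorphism. If $f$ belongs to the connected component of $H^C$ containing the constant maps, then $\sigma_{\mathcal{G}(H)}(f)=0_{\mathcal{G}(H)}$.
   Context: The exponential graph $H^C$ has as vertices all functions $V(C)\to V(H)$, with $[f,g]$ an edge (loops allowed) iff $[f(u),g(v)]\in E(H)$ for every edge $[u,v]$ of $C$. Since $H$ is connected, all constant maps lie in one component of $H^C$. $A(H)$ is the set of arcs of $H$ (each edge $[u,v]$ gives arcs $(u,v)$ and $(v,u)$). $\mathcal{G}(H)=\mathbb{Z}^{A(H)}/\theta$, where $\theta$ is the subgroup of the free abelian group $\mathbb{Z}^{A(H)}$ generated by the elements $(u,v)-(w,v)+(w,x)-(u,x)$ for every 4-cycle $u,v,w,x$ of $H$. With $V(C)=\mathbb{Z}_{2n+1}$ ($i$ adjacent to $i+1$), for a non-isolated vertex $f$ of $H^C$, $\sigma_{\mathcal{G}(H)}(f)$ is the class modulo $\theta$ of $\sum_{i=0}^{2n}\big[(f(2i),g(2i+1))-(f(2i+2),g(2i+1))\big]$ (indices mod $2n+1$), where $g$ is any neighbour of $f$ in $H^C$ (the class does not depend on $g$). -}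

module Defs where

open import Data.Nat using (ℕ; zero; suc; _+_; _*_)
open import Data.Nat.DivMod using (_mod_)
open import Data.Fin using (Fin; toℕ)
open import Data.Fin.Properties using (_≟_)
open import Data.Integer using (ℤ; 0ℤ; 1ℤ) renaming (_+_ to _+ℤ_; _-_ to _-ℤ_; _*_ to _*ℤ_)
open import Data.Product using (_×_; Σ; ∃)
open import Relation.Nullary using (yes; no)
open import Relation.Binary.PropositionalEquality using (_≡_)

-- A finite graph H on vertex set Fin size with a symmetric adjacency
-- relation (loops allowed: Adj u u may hold).
record Graph : Set₁ where
  field
    size    : ℕ
    Adj     : Fin size → Fin size → Set
    Adj-sym : ∀ {u v} → Adj u v → Adj v u
open Graph public

data Walk (H : Graph) : Fin (size H) → Fin (size H) → Set where
  here : ∀ {u} → Walk H u u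
  step : ∀ {u v w} → Adj H u v → Walk H v w → Walk H u w

Connected : Graph → Set
Connected H = ∀ u v → Walk H u v

-- The cycle with vertex set Z_{suc N}: i adjacent to i+1 (mod suc N).
ix : (N : ℕ) → ℕ → Fin (suc N)
ix N j = j mod (suc N)

nxt : (N : ℕ) → Fin (suc N) → Fin (suc N)
nxt N i = ix N (suc (toℕ i))

Map : Graph → ℕ → Set
Map H N = Fin (suc N) → Fin (size H)

IsHom : (H : Graph) (N : ℕ) → Map H N → Set
IsHom H N f = ∀ i → Adj H (f i) (f (nxt N i))

ExpAdj : (H : Graph) (N : ℕ) → Map H N → Map H N → Set
ExpAdj H N f g = ∀ i → Adj H (f i) (g (nxt N i)) × Adj H (f (nxt N i)) (g i)

data ExpWalk (H : Graph) (N : ℕ) : Map H N → Map H N → Set where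
  here : ∀ {f} → ExpWalk H N f f
  step : ∀ {f g h} → ExpAdj H N f g → ExpWalk H N g h → ExpWalk H N f h

InConstComponent : (H : Graph) (N : ℕ) → Map H N → Set
InConstComponent H N f = Σ (Fin (size H)) λ c → ExpWalk H N (λ _ → c) f

-- Z^{arcs}: integer-valued functions on ordered pairs of vertices
-- (elements of Z^{A(H)} are those supported on arcs).
Vec2 : Graph → Set
Vec2 H = Fin (size H) → Fin (size H) → ℤ

arc : (H : Graph) → Fin (size H) → Fin (size H) → Vec2 H
arc H u v a b with a ≟ u | b ≟ v
... | yes _ | yes _ = 1ℤ
... | _     | _     = 0ℤ

FourCycle : (H : Graph) → (u v w x : Fin (size H)) → Set
FourCycle H u v w x = Adj H u v × Adj H v w × Adj H w x × Adj H x u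

gen : (H : Graph) → (u v w x : Fin (size H)) → Vec2 H
gen H u v w x a b =
  ((arc H u v a b -ℤ arc H w v a b) +ℤ arc H w x a b) -ℤ arc H u x a b

-- membership in the subgroup θ generated by the 4-cycle elements
-- (finite Z-linear combinations of generators; equality pointwise)
data InTheta (H : Graph) : Vec2 H → Set where
  zero : ∀ {z} → (∀ a b → z a b ≡ 0ℤ) → InTheta H z
  add  : ∀ {y z} (u v w x : Fin (size H)) → FourCycle H u v w x → (s : ℤ) →
         InTheta H y → (∀ a b → z a b ≡ y a b +ℤ (s *ℤ gen H u v w x a b)) →
         InTheta H z

Σℤ : (n : ℕ) → (Fin n → ℤ) → ℤ
Σℤ zero    h = 0ℤ
Σℤ (suc n) h = h Fin.zero +ℤ Σℤ n (λ i → h (Fin.suc i))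
  where import Data.Fin as Fin

-- representative of σ(f) computed with the neighbour g:
-- Σ_{i=0}^{N} [ (f(2i), g(2i+1)) - (f(2i+2), g(2i+1)) ], indices mod (suc N)
sigmaVec : (H : Graph) (N : ℕ) → Map H N → Map H N → Vec2 H
sigmaVec H N f g a b = Σℤ (suc N) λ i →
  arc H (f (ix N (2 * toℕ i))) (g (ix N (2 * toℕ i + 1))) a b
  -ℤ arc H (f (ix N (2 * toℕ i + 2))) (g (ix N (2 * toℕ i + 1))) a b

-- Write σ(f, g) as Σₖ [(f(2k), g(2k+1)) − (f(2k+2), g(2k+1))]. Replacing g by another
-- neighbour g' of f changes the k-th term by the generator of θ on the 4-cycle
-- f(2k), g(2k+1), f(2k+2), g'(2k+1); replacing f by another neighbour f' of g changes it by
-- a generator plus a difference that telescopes to zero around the cycle. So along an edge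
-- f ~ f' of H^C we get σ(f', -) ≡ σ(f', f) and σ(-, f') ≡ σ(f, f') modulo θ, and membership
-- in θ propagates from a constant map c, where σ(c, g) vanishes termwise and σ(g, c)
-- telescopes to zero.
module Submission where

open import Defs
open import Data.Nat using (ℕ; zero; suc; _+_; _*_; _%_)
open import Data.Nat.Properties using (*-suc; +-comm)
open import Data.Nat.DivMod using (%-distribˡ-+; m%n%n≡m%n; [m+kn]%n≡m%n)
open import Data.Fin using (Fin; toℕ)
open import Data.Fin.Properties using (toℕ-fromℕ<; toℕ-injective)
open import Data.Integer using (ℤ; 0ℤ; 1ℤ)
  renaming (_+_ to _+ℤ_; _-_ to _-ℤ_; _*_ to _*ℤ_)
import Data.Integer.Properties as ℤₚ
open import Data.Integer.Tactic.RingSolver using (solve-∀)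
open import Data.Product using (_×_; _,_; proj₁; proj₂)
open import Function using (_∘_; id)
open import Relation.Binary.PropositionalEquality
  using (_≡_; refl; sym; trans; cong; cong₂; subst; module ≡-Reasoning)

∑ : ℕ → (ℕ → ℤ) → ℤ
∑ zero    F = 0ℤ
∑ (suc n) F = F 0 +ℤ ∑ n (F ∘ suc)

Σℤ-toℕ : ∀ n (F : ℕ → ℤ) → Σℤ n (F ∘ toℕ) ≡ ∑ n F
Σℤ-toℕ zero    F = refl
Σℤ-toℕ (suc n) F = cong (F 0 +ℤ_) (Σℤ-toℕ n (F ∘ suc))

∑-cong : ∀ n {F G : ℕ → ℤ} → (∀ k → F k ≡ G k) → ∑ n F ≡ ∑ n G
∑-cong zero    F≡G = refl
∑-cong (suc n) F≡G = cong₂ _+ℤ_ (F≡G 0) (∑-cong n (F≡G ∘ suc))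

∑-zero : ∀ n {F : ℕ → ℤ} → (∀ k → F k ≡ 0ℤ) → ∑ n F ≡ 0ℤ
∑-zero zero    F≡0 = refl
∑-zero (suc n) F≡0 = cong₂ _+ℤ_ (F≡0 0) (∑-zero n (F≡0 ∘ suc))

∑-distrib-+ : ∀ n (F G : ℕ → ℤ) → ∑ n (λ k → F k +ℤ G k) ≡ ∑ n F +ℤ ∑ n G
∑-distrib-+ zero    F G = refl
∑-distrib-+ (suc n) F G = begin
  (F 0 +ℤ G 0) +ℤ ∑ n (λ k → F (suc k) +ℤ G (suc k))
    ≡⟨ cong ((F 0 +ℤ G 0) +ℤ_) (∑-distrib-+ n (F ∘ suc) (G ∘ suc)) ⟩
  (F 0 +ℤ G 0) +ℤ (∑ n (F ∘ suc) +ℤ ∑ n (G ∘ suc))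
    ≡⟨ interchange (F 0) (G 0) (∑ n (F ∘ suc)) (∑ n (G ∘ suc)) ⟩
  (F 0 +ℤ ∑ n (F ∘ suc)) +ℤ (G 0 +ℤ ∑ n (G ∘ suc))
    ∎
  where
  open ≡-Reasoning
  interchange : ∀ a b c d → (a +ℤ b) +ℤ (c +ℤ d) ≡ (a +ℤ c) +ℤ (b +ℤ d)
  interchange = solve-∀

∑-telescope : ∀ n (F : ℕ → ℤ) → ∑ n (λ k → F k -ℤ F (suc k)) ≡ F 0 -ℤ F n
∑-telescope zero    F = sym (ℤₚ.+-inverseʳ (F 0))
∑-telescope (suc n) F =
  trans (cong ((F 0 -ℤ F 1) +ℤ_) (∑-telescope n (F ∘ suc))) (chain (F 0) (F 1) (F (suc n)))
  where
  chain : ∀ a b c → (a -ℤ b) +ℤ (b -ℤ c) ≡ a -ℤ c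
  chain = solve-∀

∑-cyclic-telescope : ∀ n (F : ℕ → ℤ) → F n ≡ F 0 →
                     ∑ n (λ k → F k -ℤ F (suc k)) ≡ 0ℤ
∑-cyclic-telescope n F Fn≡F0 = begin
  ∑ n (λ k → F k -ℤ F (suc k)) ≡⟨ ∑-telescope n F ⟩
  F 0 -ℤ F n                    ≡⟨ cong (F 0 -ℤ_) Fn≡F0 ⟩
  F 0 -ℤ F 0                    ≡⟨ ℤₚ.+-inverseʳ (F 0) ⟩
  0ℤ                            ∎
  where open ≡-Reasoning

module _ {H : Graph} where

  θ-cong : ∀ {y z} → InTheta H y → (∀ a b → z a b ≡ y a b) → InTheta H z
  θ-cong (zero y≡0)             z≡y = zero (λ a b → trans (z≡y a b) (y≡0 a b))
  θ-cong (add u v w x c s t y≡) z≡y = add u v w x c s t (λ a b → trans (z≡y a b) (y≡ a b))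

  θ-+ : ∀ {y z} → InTheta H y → InTheta H z → InTheta H (λ a b → y a b +ℤ z a b)
  θ-+ (zero y≡0) tz = θ-cong tz (λ a b → trans (cong (_+ℤ _) (y≡0 a b)) (ℤₚ.+-identityˡ _))
  θ-+ {z = z} (add {y = y'} u v w x c s t y≡) tz =
    add u v w x c s (θ-+ t tz) (λ a b →
      trans (cong (_+ℤ z a b) (y≡ a b)) (swap (y' a b) (s *ℤ gen H u v w x a b) (z a b)))
    where
    swap : ∀ p r q → (p +ℤ r) +ℤ q ≡ (p +ℤ q) +ℤ r
    swap = solve-∀

  θ-gen : ∀ {u v w x} → FourCycle H u v w x → InTheta H (gen H u v w x)
  θ-gen {u} {v} {w} {x} c = add u v w x c 1ℤ (zero {z = λ _ _ → 0ℤ} (λ _ _ → refl))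
    (λ a b → unit (gen H u v w x a b))
    where
    unit : ∀ g → g ≡ 0ℤ +ℤ (1ℤ *ℤ g)
    unit = solve-∀

  θ-∑ : ∀ n (F : ℕ → Vec2 H) → (∀ k → InTheta H (F k)) →
        InTheta H (λ a b → ∑ n (λ k → F k a b))
  θ-∑ zero    F F∈θ = zero (λ _ _ → refl)
  θ-∑ (suc n) F F∈θ = θ-+ (F∈θ 0) (θ-∑ n (F ∘ suc) (F∈θ ∘ suc))

module _ (N : ℕ) where

  ix-cong-% : ∀ j k → j % suc N ≡ k % suc N → ix N j ≡ ix N k
  ix-cong-% j k j≡k = toℕ-injective (trans (toℕ-fromℕ< _) (trans j≡k (sym (toℕ-fromℕ< _))))

  nxt-ix : ∀ j → nxt N (ix N j) ≡ ix N (suc j)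
  nxt-ix j = ix-cong-% (suc (toℕ (ix N j))) (suc j) (begin
    suc (toℕ (ix N j)) % m   ≡⟨ cong (λ i → suc i % m) (toℕ-fromℕ< _) ⟩
    (1 + j % m) % m          ≡⟨ %-distribˡ-+ 1 (j % m) m ⟩
    (1 % m + j % m % m) % m  ≡⟨ cong (λ i → (1 % m + i) % m) (m%n%n≡m%n j m) ⟩
    (1 % m + j % m) % m      ≡⟨ %-distribˡ-+ 1 j m ⟨
    suc j % m                ∎)
    where
    open ≡-Reasoning
    m = suc N

  ix-period : ∀ j → ix N (j + 2 * suc N) ≡ ix N j
  ix-period j = ix-cong-% (j + 2 * suc N) j ([m+kn]%n≡m%n j 2 (suc N))

module _ (H : Graph) (N : ℕ) where

  private
    _⟨_⟩ : Map H N → ℕ → Fin (size H)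
    f ⟨ j ⟩ = f (ix N j)

    arcAt : Map H N → ℕ → Map H N → ℕ → Vec2 H
    arcAt f i g j = arc H (f ⟨ i ⟩) (g ⟨ j ⟩)

  sigmaTerm : Map H N → Map H N → ℕ → Vec2 H
  sigmaTerm f g k a b = arcAt f (2 * k) g (suc (2 * k)) a b -ℤ arcAt f (2 * suc k) g (suc (2 * k)) a b

  sigmaVec-∑ : ∀ f g a b → sigmaVec H N f g a b ≡ ∑ (suc N) (λ k → sigmaTerm f g k a b)
  sigmaVec-∑ f g a b = trans (Σℤ-toℕ (suc N) term) (∑-cong (suc N) λ k →
      cong₂ (λ odd even → arcAt f (2 * k) g odd a b -ℤ arcAt f even g odd a b)
            (+-comm (2 * k) 1) (trans (+-comm (2 * k) 2) (sym (*-suc 2 k))))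
    where
    term : ℕ → ℤ
    term k = arcAt f (2 * k) g (2 * k + 1) a b -ℤ arcAt f (2 * k + 2) g (2 * k + 1) a b

  expAdj-sym : ∀ {f g} → ExpAdj H N f g → ExpAdj H N g f
  expAdj-sym f~g i = Adj-sym H (proj₂ (f~g i)) , Adj-sym H (proj₁ (f~g i))

  expAdj-forward : ∀ {f g} → ExpAdj H N f g → ∀ j → Adj H (f ⟨ j ⟩) (g ⟨ suc j ⟩)
  expAdj-forward {f} {g} f~g j = subst (Adj H (f ⟨ j ⟩) ∘ g) (nxt-ix N j) (proj₁ (f~g (ix N j)))

  expAdj-backward-even : ∀ {f g} → ExpAdj H N f g →
    ∀ k → Adj H (f ⟨ 2 * suc k ⟩) (g ⟨ suc (2 * k) ⟩)
  expAdj-backward-even {f} {g} f~g k =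
    subst (λ i → Adj H (f i) (g ⟨ suc (2 * k) ⟩))
          (trans (nxt-ix N (suc (2 * k))) (cong (ix N) (sym (*-suc 2 k))))
          (proj₂ (f~g (ix N (suc (2 * k)))))

  sigmaVec-transfer : ∀ {f g f' g'} (S R : ℕ → Vec2 H) → (∀ k → InTheta H (S k)) →
    (∀ a b → R (suc N) a b ≡ R 0 a b) →
    (∀ k a b → sigmaTerm f g k a b ≡
               (S k a b +ℤ sigmaTerm f' g' k a b) +ℤ (R k a b -ℤ R (suc k) a b)) →
    InTheta H (sigmaVec H N f' g') → InTheta H (sigmaVec H N f g)
  sigmaVec-transfer {f} {g} {f'} {g'} S R S∈θ R-periodic termwise σ'∈θ =
    θ-cong (θ-+ (θ-∑ (suc N) S S∈θ) σ'∈θ) decompose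
    where
    decompose : ∀ a b →
      sigmaVec H N f g a b ≡ ∑ (suc N) (λ k → S k a b) +ℤ sigmaVec H N f' g' a b
    decompose a b = begin
      sigmaVec H N f g a b
        ≡⟨ sigmaVec-∑ f g a b ⟩
      ∑ (suc N) (λ k → sigmaTerm f g k a b)
        ≡⟨ ∑-cong (suc N) (λ k → termwise k a b) ⟩
      ∑ (suc N) (λ k → (Sₖ k +ℤ T' k) +ℤ (Rₖ k -ℤ Rₖ (suc k)))
        ≡⟨ ∑-distrib-+ (suc N) (λ k → Sₖ k +ℤ T' k) (λ k → Rₖ k -ℤ Rₖ (suc k)) ⟩
      ∑ (suc N) (λ k → Sₖ k +ℤ T' k) +ℤ ∑ (suc N) (λ k → Rₖ k -ℤ Rₖ (suc k))
        ≡⟨ cong₂ _+ℤ_ (∑-distrib-+ (suc N) Sₖ T')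
                      (∑-cyclic-telescope (suc N) Rₖ (R-periodic a b)) ⟩
      (∑ (suc N) Sₖ +ℤ ∑ (suc N) T') +ℤ 0ℤ
        ≡⟨ ℤₚ.+-identityʳ _ ⟩
      ∑ (suc N) Sₖ +ℤ ∑ (suc N) T'
        ≡⟨ cong (∑ (suc N) Sₖ +ℤ_) (sigmaVec-∑ f' g' a b) ⟨
      ∑ (suc N) Sₖ +ℤ sigmaVec H N f' g' a b
        ∎
      where
      open ≡-Reasoning
      Sₖ Rₖ T' : ℕ → ℤ
      Sₖ k = S k a b
      Rₖ k = R k a b
      T' k = sigmaTerm f' g' k a b

  sigmaVec-changeʳ : ∀ {f g g'} → ExpAdj H N f g → ExpAdj H N f g' →
    InTheta H (sigmaVec H N f g') → InTheta H (sigmaVec H N f g)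
  sigmaVec-changeʳ {f} {g} {g'} f~g f~g' =
    sigmaVec-transfer {f} {g} {f} {g'} square (λ _ _ _ → 0ℤ)
      (θ-gen ∘ square-cycle) (λ _ _ → refl) termwise
    where
    square : ℕ → Vec2 H
    square k = gen H (f ⟨ 2 * k ⟩) (g ⟨ suc (2 * k) ⟩) (f ⟨ 2 * suc k ⟩) (g' ⟨ suc (2 * k) ⟩)
    square-cycle : ∀ k →
      FourCycle H (f ⟨ 2 * k ⟩) (g ⟨ suc (2 * k) ⟩) (f ⟨ 2 * suc k ⟩) (g' ⟨ suc (2 * k) ⟩)
    square-cycle k = expAdj-forward f~g (2 * k) , Adj-sym H (expAdj-backward-even f~g k)
                   , expAdj-backward-even f~g' k , Adj-sym H (expAdj-forward f~g' (2 * k))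
    identity : ∀ x y z w → x -ℤ y ≡ ((((x -ℤ y) +ℤ z) -ℤ w) +ℤ (w -ℤ z)) +ℤ (0ℤ -ℤ 0ℤ)
    identity = solve-∀
    termwise : ∀ k a b →
      sigmaTerm f g k a b ≡ (square k a b +ℤ sigmaTerm f g' k a b) +ℤ (0ℤ -ℤ 0ℤ)
    termwise k a b = identity
      (arcAt f (2 * k) g (suc (2 * k)) a b) (arcAt f (2 * suc k) g (suc (2 * k)) a b)
      (arcAt f (2 * suc k) g' (suc (2 * k)) a b) (arcAt f (2 * k) g' (suc (2 * k)) a b)

  sigmaVec-changeˡ : ∀ {f f' g} → ExpAdj H N f g → ExpAdj H N f' g →
    InTheta H (sigmaVec H N f' g) → InTheta H (sigmaVec H N f g)
  sigmaVec-changeˡ {f} {f'} {g} f~g f'~g =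
    sigmaVec-transfer {f} {g} {f'} {g} square column
      (θ-gen ∘ square-cycle) column-periodic termwise
    where
    square : ℕ → Vec2 H
    square k = gen H (f ⟨ 2 * suc k ⟩) (g ⟨ suc (2 * suc k) ⟩) (f' ⟨ 2 * suc k ⟩) (g ⟨ suc (2 * k) ⟩)
    square-cycle : ∀ k →
      FourCycle H (f ⟨ 2 * suc k ⟩) (g ⟨ suc (2 * suc k) ⟩) (f' ⟨ 2 * suc k ⟩) (g ⟨ suc (2 * k) ⟩)
    square-cycle k = expAdj-forward f~g (2 * suc k) , Adj-sym H (expAdj-forward f'~g (2 * suc k))
                   , expAdj-backward-even f'~g k , Adj-sym H (expAdj-backward-even f~g k)
    column : ℕ → Vec2 H
    column k a b = arcAt f (2 * k) g (suc (2 * k)) a b -ℤ arcAt f' (2 * k) g (suc (2 * k)) a b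
    column-periodic : ∀ a b → column (suc N) a b ≡ column 0 a b
    column-periodic a b = cong₂ (λ i j → arc H (f i) (g j) a b -ℤ arc H (f' i) (g j) a b)
                                (ix-period N 0) (ix-period N 1)
    identity : ∀ x₁ y₁ x₂ y₂ z₁ z₂ →
      x₁ -ℤ y₁ ≡ ((((z₁ -ℤ z₂) +ℤ y₂) -ℤ y₁) +ℤ (x₂ -ℤ y₂)) +ℤ ((x₁ -ℤ x₂) -ℤ (z₁ -ℤ z₂))
    identity = solve-∀
    termwise : ∀ k a b → sigmaTerm f g k a b ≡
      (square k a b +ℤ sigmaTerm f' g k a b) +ℤ (column k a b -ℤ column (suc k) a b)
    termwise k a b = identity
      (arcAt f (2 * k) g (suc (2 * k)) a b) (arcAt f (2 * suc k) g (suc (2 * k)) a b)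
      (arcAt f' (2 * k) g (suc (2 * k)) a b) (arcAt f' (2 * suc k) g (suc (2 * k)) a b)
      (arcAt f (2 * suc k) g (suc (2 * suc k)) a b)
      (arcAt f' (2 * suc k) g (suc (2 * suc k)) a b)

  sigmaVec-constˡ : ∀ c g → InTheta H (sigmaVec H N (λ _ → c) g)
  sigmaVec-constˡ c g = zero λ a b →
    trans (sigmaVec-∑ (λ _ → c) g a b)
          (∑-zero (suc N) (λ k → ℤₚ.+-inverseʳ (arc H c (g ⟨ suc (2 * k) ⟩) a b)))

  sigmaVec-constʳ : ∀ f c → InTheta H (sigmaVec H N f (λ _ → c))
  sigmaVec-constʳ f c = zero λ a b →
    trans (sigmaVec-∑ f (λ _ → c) a b)
          (∑-cyclic-telescope (suc N) (λ k → arc H (f ⟨ 2 * k ⟩) c a b)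
                              (cong (λ i → arc H (f i) c a b) (ix-period N 0)))

  SigmaVanishesAround : Map H N → Set
  SigmaVanishesAround f = (∀ g → ExpAdj H N f g → InTheta H (sigmaVec H N f g))
                        × (∀ g → ExpAdj H N g f → InTheta H (sigmaVec H N g f))

  sigmaVanishesAround-const : ∀ c → SigmaVanishesAround (λ _ → c)
  sigmaVanishesAround-const c = (λ g _ → sigmaVec-constˡ c g) , (λ g _ → sigmaVec-constʳ g c)

  sigmaVanishesAround-step : ∀ {f f'} → ExpAdj H N f f' →
    SigmaVanishesAround f → SigmaVanishesAround f'
  sigmaVanishesAround-step {f} {f'} f~f' (σ-from-f , σ-at-f) =
    (λ g f'~g → sigmaVec-changeʳ {f'} {g} {f} f'~g f'~f (σ-at-f f' f'~f)) ,
    (λ g g~f' → sigmaVec-changeˡ {g} {f} {f'} g~f' f~f' (σ-from-f f' f~f'))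
    where
    f'~f : ExpAdj H N f' f
    f'~f = expAdj-sym f~f'

  sigmaVanishesAround-walk : ∀ {f f'} → ExpWalk H N f f' →
    SigmaVanishesAround f → SigmaVanishesAround f'
  sigmaVanishesAround-walk here         = id
  sigmaVanishesAround-walk (step f~g w) = sigmaVanishesAround-walk w ∘ sigmaVanishesAround-step f~g

  sigmaVec-constComponent : ∀ {f} → InConstComponent H N f →
    ∀ g → ExpAdj H N f g → InTheta H (sigmaVec H N f g)
  sigmaVec-constComponent (c , walk) =
    proj₁ (sigmaVanishesAround-walk walk (sigmaVanishesAround-const c))

corollary7 : (H : Graph) → Connected H → (n : ℕ) →
    (f : Map H (2 * suc n)) → IsHom H (2 * suc n) f →
    InConstComponent H (2 * suc n) f →
    (g : Map H (2 * suc n)) → ExpAdj H (2 * suc n) f g →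
    InTheta H (sigmaVec H (2 * suc n) f g)
corollary7 H _ n f _ = sigmaVec-constComponent H (2 * suc n)
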